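{- The graph $G_{12}$ is not $\cup$-triangle; that is, neither $G_{12}$ nor its complement is a triangle graph.
   Context: $G_{12}$ is the graph on vertex set $\{1,\dots,12\}$ in which two distinct vertices are adjacent iff they lie together in some member of $\{\{1,4,7\},\{2,4,5,6\},\{2,4,6,7\},\{2,4,6,9\},\{2,4,9,12\},\{2,5,8\},\{2,6,7,11\},\{2,11,12\},\{3,6,9\},\{4,5,6,10\},\{4,10,12\},\{6,10,11\},\{10,11,12\}\}$ (these are exactly its maximal cliques); its maximal stable sets are $\{1,2,3,10\},\{1,3,5,11\},\{1,3,5,12\},\{1,3,8,10\},\{1,3,8,11\},\{1,3,8,12\},\{1,5,9,11\},\{1,6,8,12\},\{1,8,9,10\},\{1,8,9,11\},\{3,4,8,11\},\{3,5,7,12\},\{3,7,8,10\},\{3,7,8,12\},\{5,7,9\},\{7,8,9,10\}$. A graph $G$ is triangle if for every maximal stable set $S$ and every edge $uv$ with $u,v\notin S$ there is $s\in S$ adjacent to both $u$ and $v$. -}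

module Defs where

open import Data.Nat using (ℕ; suc)
open import Data.Fin using (Fin; toℕ)
open import Data.List using (List; []; _∷_)
open import Data.List.Membership.Propositional using (_∈_)
open import Data.List.Relation.Unary.Any using (Any)
open import Data.Product using (Σ; _×_; ∃-syntax; _,_; proj₁; proj₂)
open import Relation.Nullary using (¬_)
open import Relation.Binary.PropositionalEquality using (_≡_; _≢_; refl; sym)
import Data.List.Relation.Unary.Any as Any

record Graph (n : ℕ) : Set₁ where
  field
    Adj       : Fin n → Fin n → Set
    irrefl    : ∀ u → ¬ Adj u u
    symmetric : ∀ u v → Adj u v → Adj v u
open Graph public

VSet : ℕ → Set₁
VSet n = Fin n → Set

_⊆ᵥ_ : ∀ {n} → VSet n → VSet n → Set
S ⊆ᵥ T = ∀ v → S v → T v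

Stable : ∀ {n} → Graph n → VSet n → Set
Stable G S = ∀ u v → S u → S v → ¬ Adj G u v

MaximalStable : ∀ {n} → Graph n → VSet n → Set₁
MaximalStable G S = Stable G S × (∀ (T : VSet _) → Stable G T → S ⊆ᵥ T → T ⊆ᵥ S)

IsTriangle : ∀ {n} → Graph n → Set₁
IsTriangle G = ∀ (S : VSet _) → MaximalStable G S →
  ∀ u v → Adj G u v → ¬ S u → ¬ S v →
  ∃[ s ] (S s × Adj G s u × Adj G s v)

complement : ∀ {n} → Graph n → Graph n
complement G = record
  { Adj = λ u v → u ≢ v × ¬ Adj G u v
  ; irrefl = λ u p → proj₁ p refl
  ; symmetric = λ u v p → (λ e → proj₁ p (sym e))
                         , (λ a → proj₂ p (symmetric G v u a))
  }

-- The maximal cliques of G₁₂, with vertices labelled 1..12.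
cliques₁₂ : List (List ℕ)
cliques₁₂ =
  (1 ∷ 4 ∷ 7 ∷ []) ∷ (2 ∷ 4 ∷ 5 ∷ 6 ∷ []) ∷ (2 ∷ 4 ∷ 6 ∷ 7 ∷ []) ∷
  (2 ∷ 4 ∷ 6 ∷ 9 ∷ []) ∷ (2 ∷ 4 ∷ 9 ∷ 12 ∷ []) ∷ (2 ∷ 5 ∷ 8 ∷ []) ∷
  (2 ∷ 6 ∷ 7 ∷ 11 ∷ []) ∷ (2 ∷ 11 ∷ 12 ∷ []) ∷ (3 ∷ 6 ∷ 9 ∷ []) ∷
  (4 ∷ 5 ∷ 6 ∷ 10 ∷ []) ∷ (4 ∷ 10 ∷ 12 ∷ []) ∷ (6 ∷ 10 ∷ 11 ∷ []) ∷
  (10 ∷ 11 ∷ 12 ∷ []) ∷ []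

label : Fin 12 → ℕ
label i = suc (toℕ i)

Adj₁₂ : Fin 12 → Fin 12 → Set
Adj₁₂ u v = u ≢ v × Any (λ c → label u ∈ c × label v ∈ c) cliques₁₂

G₁₂ : Graph 12
G₁₂ = record
  { Adj = Adj₁₂
  ; irrefl = λ u p → proj₁ p refl
  ; symmetric = λ u v p →
      (λ e → proj₁ p (sym e))
      , Any.map (λ { (a , b) → b , a }) (proj₂ p)
  }

module Submission where

-- A graph G fails to be triangle as soon as it has an *obstruction*: a
-- maximal stable set S together with an edge uv disjoint from S such that
-- no vertex of S is adjacent to both u and v.  For a finite S given as a
-- list, maximality is certified by domination: a stable list S such that
-- every vertex lies in S or has a neighbour in S is a maximal stable set.

open import Defs
open import Data.Nat using (ℕ)
import Data.Nat as ℕ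
open import Data.Fin using (Fin; #_)
import Data.Fin as Fin
import Data.Fin.Properties as Fin
open import Data.List using (List; []; _∷_)
open import Data.List.Membership.Propositional using (_∈_)
import Data.List.Membership.DecPropositional as DecMembership
open import Data.List.Relation.Unary.Any as Any using (Any; here; there)
open import Data.List.Relation.Unary.All as All using (All)
open import Data.Product using (_×_; _,_; ∃-syntax)
open import Data.Sum using (_⊎_; inj₁; inj₂)
open import Data.Empty using (⊥-elim)
open import Relation.Nullary using (¬_; Dec)
open import Relation.Nullary.Decidable using (True; toWitness; _×-dec_; _⊎-dec_; ¬?)
open import Relation.Binary.PropositionalEquality using (refl)

module _ {n : ℕ} (G : Graph n) where

  listSet : List (Fin n) → VSet n
  listSet xs v = v ∈ xs

  Dominating : List (Fin n) → Set
  Dominating xs = ∀ v → v ∈ xs ⊎ Any (Adj G v) xs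

  stable-avoids-neighbours : ∀ {T : VSet n} {v xs} → Stable G T → T v →
                             listSet xs ⊆ᵥ T → ¬ Any (Adj G v) xs
  stable-avoids-neighbours {v = v} stT Tv xs⊆T (here v~x) =
    stT v _ Tv (xs⊆T _ (here refl)) v~x
  stable-avoids-neighbours stT Tv xs⊆T (there v~xs) =
    stable-avoids-neighbours stT Tv (λ s s∈xs → xs⊆T s (there s∈xs)) v~xs

  -- A dominating stable set is maximal stable: any stable superset T
  -- cannot contain a vertex outside xs, since that vertex has a neighbour
  -- in xs ⊆ T.
  dominating-stable⇒maximal : ∀ {xs} → Stable G (listSet xs) → Dominating xs →
                              MaximalStable G (listSet xs)
  dominating-stable⇒maximal {xs} stable dominating = stable , maximal
    where
    maximal : ∀ (T : VSet n) → Stable G T → listSet xs ⊆ᵥ T → T ⊆ᵥ listSet xs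
    maximal T stT xs⊆T v Tv with dominating v
    ... | inj₁ v∈xs = v∈xs
    ... | inj₂ v~xs = ⊥-elim (stable-avoids-neighbours stT Tv xs⊆T v~xs)

  record Obstruction : Set where
    field
      core        : List (Fin n)
      stable      : Stable G (listSet core)
      dominating  : Dominating core
      u v         : Fin n
      edge        : Adj G u v
      u∉core      : ¬ u ∈ core
      v∉core      : ¬ v ∈ core
      no-common   : All (λ s → ¬ (Adj G s u × Adj G s v)) core

  obstruction⇒¬triangle : Obstruction → ¬ IsTriangle G
  obstruction⇒¬triangle ob triangle =
    no-common-vertex (triangle (listSet core)
                               (dominating-stable⇒maximal stable dominating)
                               u v edge u∉core v∉core)
    where
    open Obstruction ob
    no-common-vertex : ¬ (∃[ s ] (listSet core s × Adj G s u × Adj G s v))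
    no-common-vertex (s , s∈core , s~u , s~v) =
      All.lookup no-common s∈core (s~u , s~v)

complement-dec : ∀ {n} {G : Graph n} → (∀ u v → Dec (Adj G u v)) →
                 ∀ u v → Dec (Adj (complement G) u v)
complement-dec adj? u v = ¬? (u Fin.≟ v) ×-dec ¬? (adj? u v)

-- For a graph with decidable adjacency, each condition of an obstruction
-- is decidable; the "…-by-evaluation" forms let the type checker discharge
-- them for concrete data.
module Decide {n : ℕ} (G : Graph n) (adj? : ∀ u v → Dec (Adj G u v)) where
  open DecMembership (Fin._≟_ {n}) using (_∈?_)

  stable? : ∀ xs → Dec (All (λ a → All (λ b → ¬ Adj G a b) xs) xs)
  stable? xs = All.all? (λ a → All.all? (λ b → ¬? (adj? a b)) xs) xs

  stable-by-evaluation : ∀ xs → {True (stable? xs)} → Stable G (listSet G xs)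
  stable-by-evaluation xs {ok} a b a∈xs b∈xs =
    All.lookup (All.lookup (toWitness ok) a∈xs) b∈xs

  dominating-by-evaluation : ∀ xs →
    {True (Fin.all? (λ v → (v ∈? xs) ⊎-dec Any.any? (adj? v) xs))} →
    Dominating G xs
  dominating-by-evaluation xs {ok} = toWitness ok

  no-common-by-evaluation : ∀ xs u v →
    {True (All.all? (λ s → ¬? (adj? s u ×-dec adj? s v)) xs)} →
    All (λ s → ¬ (Adj G s u × Adj G s v)) xs
  no-common-by-evaluation xs u v {ok} = toWitness ok

  edge-by-evaluation : ∀ u v → {True (adj? u v)} → Adj G u v
  edge-by-evaluation u v {ok} = toWitness ok

  outside-by-evaluation : ∀ v xs → {True (¬? (v ∈? xs))} → ¬ v ∈ xs
  outside-by-evaluation v xs {ok} = toWitness ok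

adj₁₂? : ∀ u v → Dec (Adj₁₂ u v)
adj₁₂? u v = ¬? (u Fin.≟ v) ×-dec
             Any.any? (λ c → (label u ∈ℕ? c) ×-dec (label v ∈ℕ? c)) cliques₁₂
  where open DecMembership ℕ._≟_ renaming (_∈?_ to _∈ℕ?_)

-- {5,7,9} is a maximal stable set of G₁₂, and 10, 11 are adjacent with no
-- common neighbour in it.
obstruction₁₂ : Obstruction G₁₂
obstruction₁₂ = record
  { core       = core
  ; stable     = stable-by-evaluation core
  ; dominating = dominating-by-evaluation core
  ; u = # 9 ; v = # 10
  ; edge       = edge-by-evaluation (# 9) (# 10)
  ; u∉core     = outside-by-evaluation (# 9) core
  ; v∉core     = outside-by-evaluation (# 10) core
  ; no-common  = no-common-by-evaluation core (# 9) (# 10)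
  }
  where
  open Decide G₁₂ adj₁₂?
  core : List (Fin 12)
  core = # 4 ∷ # 6 ∷ # 8 ∷ []

-- {2,11,12} is a maximal stable set of the complement, and 7, 9 are
-- adjacent in the complement with no common complement-neighbour in it.
obstructionᶜ₁₂ : Obstruction (complement G₁₂)
obstructionᶜ₁₂ = record
  { core       = core
  ; stable     = stable-by-evaluation core
  ; dominating = dominating-by-evaluation core
  ; u = # 6 ; v = # 8
  ; edge       = edge-by-evaluation (# 6) (# 8)
  ; u∉core     = outside-by-evaluation (# 6) core
  ; v∉core     = outside-by-evaluation (# 8) core
  ; no-common  = no-common-by-evaluation core (# 6) (# 8)
  }
  where
  open Decide (complement G₁₂) (complement-dec {G = G₁₂} adj₁₂?)
  core : List (Fin 12)
  core = # 1 ∷ # 10 ∷ # 11 ∷ []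

proposition42 : ¬ IsTriangle G₁₂ × ¬ IsTriangle (complement G₁₂)
proposition42 = obstruction⇒¬triangle G₁₂ obstruction₁₂
              , obstruction⇒¬triangle (complement G₁₂) obstructionᶜ₁₂
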